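{- For all raw terms $t_1,t_2,t_3$: if $t_1\rhd_\varepsilon t_2$ and $t_2\rhd_\beta t_3$, then there exists a raw term $t_4$ such that $t_1\rhd_\beta t_4$ and $t_4\rhd_\varepsilon^* t_3$.
   Context: Sorts are $\mathsf{Prop}$ and $\mathsf{Type}(i)$ for $i\in\mathbb N$. Tags are $*$ and $\diamond$; every variable carries a tag. Raw terms are generated by $t ::= s \mid x_{\mathsf s} \mid \lambda x_{\mathsf s}:t.\,t \mid (t\;t) \mid \Pi x_{\mathsf s}:t.\,t \mid \Sigma^{\mathsf s} x_{\mathsf s}:t.\,t \mid \langle t,t\rangle_{\Sigma^{\mathsf s}x_{\mathsf s}:t.\,t} \mid \pi_1(t) \mid \pi_2^{\mathsf s}(t) \mid \varepsilon$ ($s$ a sort, $\mathsf s$ a tag, $\varepsilon$ a constant), up to $\alpha$-conversion; contextual closure means rewriting at any subterm. Extraction $\rhd_\varepsilon$ is the contextual closure of $x_*\rhd_\varepsilon\varepsilon$, $\lambda x:A.\varepsilon\rhd_\varepsilon\varepsilon$, $(\varepsilon\;t)\rhd_\varepsilon\varepsilon$, $\pi_2^*(t)\rhd_\varepsilon\varepsilon$; $\rhd_\varepsilon^*$ is its reflexive-transitive closure. The tag $s(t)$ is $*$ if $t\rhd_\varepsilon^*\varepsilon$ and $\diamond$ otherwise. $\rhd_\beta$ (one step) is the contextual closure of $((\lambda x_{\mathsf s}:A.t)\;u)\rhd_\beta t[x_{\mathsf s}\setminus u]$ if $s(u)=\mathsf s$; $\pi_1(\langle a,b\rangle_{\Sigma^{\mathsf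 s'}x:A.B})\rhd_\beta a$ if $s(a)=\diamond$; $\pi_2^{\mathsf s}(\langle a,b\rangle_{\Sigma^{\mathsf s'}x:A.B})\rhd_\beta b$ if $s(b)=\mathsf s$. -}

module Defs where

open import Data.Nat using (ℕ; zero; suc; compare; less; equal; greater; _+_)
open import Data.Empty using (⊥)
open import Relation.Nullary using (¬_)
open import Relation.Binary.Construct.Closure.ReflexiveTransitive using (Star)

data Sort : Set where
  Prop : Sort
  Type : ℕ → Sort

data Tag : Set where
  star diam : Tag

-- Raw terms, up to α-conversion, via de Bruijn indices.
-- Variables carry a tag; the two tags are separate variable namespaces:
-- 'var s n' is the variable of tag s bound by the n-th enclosing binder
-- of tag s (or a free variable of tag s if there are fewer).
data Term : Set where
  sort : Sort → Term
  var  : Tag → ℕ → Term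
  lam  : Tag → Term → Term → Term
  app  : Term → Term → Term
  pi   : Tag → Term → Term → Term
  sig  : Tag → Term → Term → Term
  pair : Term → Term → Tag → Term → Term → Term
    -- ⟨a , b⟩_{Σ^s x_s : A . B}  is  pair a b s A B  (B under the binder)
  pr1  : Term → Term
  pr2  : Tag → Term → Term
  eps  : Term

-- cutoff update when passing a binder of tag b, for namespace s
bump : Tag → Tag → ℕ → ℕ
bump star star c = suc c
bump diam diam c = suc c
bump star diam c = c
bump diam star c = c

shiftVar : Tag → ℕ → Tag → ℕ → Term
shiftVarN : ℕ → ℕ → ℕ
shiftVarN zero n = suc n
shiftVarN (suc c) zero = zero
shiftVarN (suc c) (suc n) = suc (shiftVarN c n)
shiftVar star c star n = var star (shiftVarN c n)
shiftVar diam c diam n = var diam (shiftVarN c n)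
shiftVar star c diam n = var diam n
shiftVar diam c star n = var star n

shift : Tag → ℕ → Term → Term
shift s c (sort k) = sort k
shift s c (var s' n) = shiftVar s c s' n
shift s c (lam b A t) = lam b (shift s c A) (shift s (bump b s c) t)
shift s c (app t u) = app (shift s c t) (shift s c u)
shift s c (pi b A B) = pi b (shift s c A) (shift s (bump b s c) B)
shift s c (sig b A B) = sig b (shift s c A) (shift s (bump b s c) B)
shift s c (pair a b' b A B) =
  pair (shift s c a) (shift s c b') b (shift s c A) (shift s (bump b s c) B)
shift s c (pr1 t) = pr1 (shift s c t)
shift s c (pr2 b t) = pr2 b (shift s c t)
shift s c eps = eps

-- substituting u for the tag-s variable with index k; higher tag-s indices
-- are decremented (the binder is removed)
substVarN : Tag → ℕ → ℕ → Term → Term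
substVarN s k n u with compare n k
... | less .n _ = var s n
... | equal .n = u
... | greater .k m = var s (k + m)

substVar : Tag → ℕ → Term → Tag → ℕ → Term
substVar star k u star n = substVarN star k n u
substVar diam k u diam n = substVarN diam k n u
substVar star k u diam n = var diam n
substVar diam k u star n = var star n

subst : Tag → ℕ → Term → Term → Term
subst s k u (sort i) = sort i
subst s k u (var s' n) = substVar s k u s' n
subst s k u (lam b A t) = lam b (subst s k u A) (subst s (bump b s k) (shift b 0 u) t)
subst s k u (app t v) = app (subst s k u t) (subst s k u v)
subst s k u (pi b A B) = pi b (subst s k u A) (subst s (bump b s k) (shift b 0 u) B)
subst s k u (sig b A B) = sig b (subst s k u A) (subst s (bump b s k) (shift b 0 u) B)
subst s k u (pair a b' b A B) =
  pair (subst s k u a) (subst s k u b') b (subst s k u A)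
       (subst s (bump b s k) (shift b 0 u) B)
subst s k u (pr1 t) = pr1 (subst s k u t)
subst s k u (pr2 b t) = pr2 b (subst s k u t)
subst s k u eps = eps

_[_≔_] : Term → Tag → Term → Term
t [ s ≔ u ] = subst s 0 u t

data Ctx (R : Term → Term → Set) : Term → Term → Set where
  base  : ∀ {t t'} → R t t' → Ctx R t t'
  lam₁  : ∀ {b A A' t} → Ctx R A A' → Ctx R (lam b A t) (lam b A' t)
  lam₂  : ∀ {b A t t'} → Ctx R t t' → Ctx R (lam b A t) (lam b A t')
  app₁  : ∀ {t t' u} → Ctx R t t' → Ctx R (app t u) (app t' u)
  app₂  : ∀ {t u u'} → Ctx R u u' → Ctx R (app t u) (app t u')
  pi₁   : ∀ {b A A' B} → Ctx R A A' → Ctx R (pi b A B) (pi b A' B)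
  pi₂   : ∀ {b A B B'} → Ctx R B B' → Ctx R (pi b A B) (pi b A B')
  sig₁  : ∀ {b A A' B} → Ctx R A A' → Ctx R (sig b A B) (sig b A' B)
  sig₂  : ∀ {b A B B'} → Ctx R B B' → Ctx R (sig b A B) (sig b A B')
  pair₁ : ∀ {a a' c b A B} → Ctx R a a' → Ctx R (pair a c b A B) (pair a' c b A B)
  pair₂ : ∀ {a c c' b A B} → Ctx R c c' → Ctx R (pair a c b A B) (pair a c' b A B)
  pair₃ : ∀ {a c b A A' B} → Ctx R A A' → Ctx R (pair a c b A B) (pair a c b A' B)
  pair₄ : ∀ {a c b A B B'} → Ctx R B B' → Ctx R (pair a c b A B) (pair a c b A B')
  pr1₁  : ∀ {t t'} → Ctx R t t' → Ctx R (pr1 t) (pr1 t')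
  pr2₁  : ∀ {b t t'} → Ctx R t t' → Ctx R (pr2 b t) (pr2 b t')

data ExtrBase : Term → Term → Set where
  e-var : ∀ {n} → ExtrBase (var star n) eps
  e-lam : ∀ {b A} → ExtrBase (lam b A eps) eps
  e-app : ∀ {t} → ExtrBase (app eps t) eps
  e-pr2 : ∀ {t} → ExtrBase (pr2 star t) eps

_▷ε_ : Term → Term → Set
_▷ε_ = Ctx ExtrBase

_▷ε*_ : Term → Term → Set
_▷ε*_ = Star _▷ε_

HasTag : Term → Tag → Set
HasTag t star = t ▷ε* eps
HasTag t diam = ¬ (t ▷ε* eps)

data BetaBase : Term → Term → Set where
  b-app : ∀ {b A t u} → HasTag u b → BetaBase (app (lam b A t) u) (t [ b ≔ u ])
  b-pr1 : ∀ {a c b A B} → HasTag a diam → BetaBase (pr1 (pair a c b A B)) a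
  b-pr2 : ∀ {s a c b A B} → HasTag c s → BetaBase (pr2 s (pair a c b A B)) c

_▷β_ : Term → Term → Set
_▷β_ = Ctx BetaBase

module Submission where

open import Defs
open import Data.Empty using (⊥-elim)
open import Data.Product using (∃-syntax; _×_; _,_)
open import Data.Nat using (compare; less; equal; greater)
open import Relation.Nullary using (¬_)
open import Relation.Binary.PropositionalEquality using (_≡_; refl)
open import Relation.Binary.Construct.Closure.ReflexiveTransitive
  using (ε; _◅_; _◅◅_; gmap)

data Extractable : Term → Set where
  ex-eps : Extractable eps
  ex-var : ∀ {n} → Extractable (var star n)
  ex-lam : ∀ {b A t} → Extractable t → Extractable (lam b A t)
  ex-app : ∀ {t u} → Extractable t → Extractable (app t u)
  ex-pr2 : ∀ {t} → Extractable (pr2 star t)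

extractable-sound : ∀ {t} → Extractable t → t ▷ε* eps
extractable-sound ex-eps     = ε
extractable-sound ex-var     = base e-var ◅ ε
extractable-sound (ex-lam x) = gmap _ lam₂ (extractable-sound x) ◅◅ (base e-lam ◅ ε)
extractable-sound (ex-app x) = gmap _ app₁ (extractable-sound x) ◅◅ (base e-app ◅ ε)
extractable-sound ex-pr2     = base e-pr2 ◅ ε

extractable-backward : ∀ {t t'} → t ▷ε t' → Extractable t' → Extractable t
extractable-backward (base e-var) _           = ex-var
extractable-backward (base e-lam) _           = ex-lam ex-eps
extractable-backward (base e-app) _           = ex-app ex-eps
extractable-backward (base e-pr2) _           = ex-pr2
extractable-backward (lam₁ e)     (ex-lam x)  = ex-lam x
extractable-backward (lam₂ e)     (ex-lam x)  = ex-lam (extractable-backward e x)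
extractable-backward (app₁ e)     (ex-app x)  = ex-app (extractable-backward e x)
extractable-backward (app₂ e)     (ex-app x)  = ex-app x
extractable-backward (pr2₁ e)     ex-pr2      = ex-pr2

extractable-forward : ∀ {t t'} → t ▷ε t' → Extractable t → Extractable t'
extractable-forward (base e-var) _           = ex-eps
extractable-forward (base e-lam) _           = ex-eps
extractable-forward (base e-app) _           = ex-eps
extractable-forward (base e-pr2) _           = ex-eps
extractable-forward (lam₁ e)     (ex-lam x)  = ex-lam x
extractable-forward (lam₂ e)     (ex-lam x)  = ex-lam (extractable-forward e x)
extractable-forward (app₁ e)     (ex-app x)  = ex-app (extractable-forward e x)
extractable-forward (app₂ e)     (ex-app x)  = ex-app x
extractable-forward (pr2₁ e)     ex-pr2      = ex-pr2

extractable-complete : ∀ {t} → t ▷ε* eps → Extractable t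
extractable-complete ε       = ex-eps
extractable-complete (e ◅ r) = extractable-backward e (extractable-complete r)

-- An extraction step never changes the tag: if u ▷ε u' and s(u') = s then
-- s(u) = s.  For ◇ this needs that ▷ε* ε is preserved forward by ▷ε.
tag-backward : ∀ s {u u'} → u ▷ε u' → HasTag u' s → HasTag u s
tag-backward star e h = e ◅ h
tag-backward diam e h = λ r →
  h (extractable-sound (extractable-forward e (extractable-complete r)))

shift-▷ε : ∀ s c {t t'} → t ▷ε t' → shift s c t ▷ε shift s c t'
shift-▷ε star c (base e-var)      = base e-var
shift-▷ε diam c (base e-var)      = base e-var
shift-▷ε s    c (base e-lam)      = base e-lam
shift-▷ε s    c (base e-app)      = base e-app
shift-▷ε s    c (base e-pr2)      = base e-pr2
shift-▷ε s    c (lam₁ e)          = lam₁ (shift-▷ε s c e)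
shift-▷ε s    c (lam₂ {b} e)      = lam₂ (shift-▷ε s (bump b s c) e)
shift-▷ε s    c (app₁ e)          = app₁ (shift-▷ε s c e)
shift-▷ε s    c (app₂ e)          = app₂ (shift-▷ε s c e)
shift-▷ε s    c (pi₁ e)           = pi₁ (shift-▷ε s c e)
shift-▷ε s    c (pi₂ {b} e)       = pi₂ (shift-▷ε s (bump b s c) e)
shift-▷ε s    c (sig₁ e)          = sig₁ (shift-▷ε s c e)
shift-▷ε s    c (sig₂ {b} e)      = sig₂ (shift-▷ε s (bump b s c) e)
shift-▷ε s    c (pair₁ e)         = pair₁ (shift-▷ε s c e)
shift-▷ε s    c (pair₂ e)         = pair₂ (shift-▷ε s c e)
shift-▷ε s    c (pair₃ e)         = pair₃ (shift-▷ε s c e)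
shift-▷ε s    c (pair₄ {b = b} e) = pair₄ (shift-▷ε s (bump b s c) e)
shift-▷ε s    c (pr1₁ e)          = pr1₁ (shift-▷ε s c e)
shift-▷ε s    c (pr2₁ e)          = pr2₁ (shift-▷ε s c e)

-- The hypothesis under which substituting u for tag-s variables is compatible
-- with extraction of those variables: *-variables may only be replaced by
-- terms that themselves extract to ε.
ExtractsIfStar : Tag → Term → Set
ExtractsIfStar s u = s ≡ star → u ▷ε* eps

shift-extractsIfStar : ∀ s b c {u} → ExtractsIfStar s u → ExtractsIfStar s (shift b c u)
shift-extractsIfStar s b c h p = gmap (shift b c) (shift-▷ε b c) (h p)

-- A *-variable after substitution is either a variable or u; both extract.
substVarN-extracts : ∀ k n {u} → u ▷ε* eps → substVarN star k n u ▷ε* eps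
substVarN-extracts k n h with compare n k
... | less _ _    = base e-var ◅ ε
... | equal _     = h
... | greater _ _ = base e-var ◅ ε

-- An extraction step in the body survives substitution (as several steps,
-- since an extracted *-variable becomes a copy of u).
subst-body-▷ε : ∀ s k {u t t'} → ExtractsIfStar s u → t ▷ε t' →
                subst s k u t ▷ε* subst s k u t'
subst-body-▷ε star k hu (base (e-var {n})) = substVarN-extracts k n (hu refl)
subst-body-▷ε diam k hu (base e-var)      = base e-var ◅ ε
subst-body-▷ε s k hu (base e-lam)      = base e-lam ◅ ε
subst-body-▷ε s k hu (base e-app)      = base e-app ◅ ε
subst-body-▷ε s k hu (base e-pr2)      = base e-pr2 ◅ ε
subst-body-▷ε s k hu (lam₁ e)          = gmap _ lam₁ (subst-body-▷ε s k hu e)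
subst-body-▷ε s k hu (lam₂ {b} e)      =
  gmap _ lam₂ (subst-body-▷ε s (bump b s k) (shift-extractsIfStar s b 0 hu) e)
subst-body-▷ε s k hu (app₁ e)          = gmap _ app₁ (subst-body-▷ε s k hu e)
subst-body-▷ε s k hu (app₂ e)          = gmap _ app₂ (subst-body-▷ε s k hu e)
subst-body-▷ε s k hu (pi₁ e)           = gmap _ pi₁ (subst-body-▷ε s k hu e)
subst-body-▷ε s k hu (pi₂ {b} e)       =
  gmap _ pi₂ (subst-body-▷ε s (bump b s k) (shift-extractsIfStar s b 0 hu) e)
subst-body-▷ε s k hu (sig₁ e)          = gmap _ sig₁ (subst-body-▷ε s k hu e)
subst-body-▷ε s k hu (sig₂ {b} e)      =
  gmap _ sig₂ (subst-body-▷ε s (bump b s k) (shift-extractsIfStar s b 0 hu) e)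
subst-body-▷ε s k hu (pair₁ e)         = gmap _ pair₁ (subst-body-▷ε s k hu e)
subst-body-▷ε s k hu (pair₂ e)         = gmap _ pair₂ (subst-body-▷ε s k hu e)
subst-body-▷ε s k hu (pair₃ e)         = gmap _ pair₃ (subst-body-▷ε s k hu e)
subst-body-▷ε s k hu (pair₄ {b = b} e) =
  gmap _ pair₄ (subst-body-▷ε s (bump b s k) (shift-extractsIfStar s b 0 hu) e)
subst-body-▷ε s k hu (pr1₁ e)          = gmap _ pr1₁ (subst-body-▷ε s k hu e)
subst-body-▷ε s k hu (pr2₁ e)          = gmap _ pr2₁ (subst-body-▷ε s k hu e)

-- An extraction step in the substituted term u is replayed at every occurrence.
substVarN-arg-▷ε : ∀ s k n {u u'} → u ▷ε u' → substVarN s k n u ▷ε* substVarN s k n u'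
substVarN-arg-▷ε s k n e with compare n k
... | less _ _    = ε
... | equal _     = e ◅ ε
... | greater _ _ = ε

subst-arg-▷ε : ∀ s k t {u u'} → u ▷ε u' → subst s k u t ▷ε* subst s k u' t
subst-arg-▷ε s    k (sort _)     e = ε
subst-arg-▷ε star k (var star n) e = substVarN-arg-▷ε star k n e
subst-arg-▷ε star k (var diam n) e = ε
subst-arg-▷ε diam k (var star n) e = ε
subst-arg-▷ε diam k (var diam n) e = substVarN-arg-▷ε diam k n e
subst-arg-▷ε s    k (lam b A t)  e =
  gmap _ lam₁ (subst-arg-▷ε s k A e) ◅◅
  gmap _ lam₂ (subst-arg-▷ε s (bump b s k) t (shift-▷ε b 0 e))
subst-arg-▷ε s    k (app t v)    e =
  gmap _ app₁ (subst-arg-▷ε s k t e) ◅◅ gmap _ app₂ (subst-arg-▷ε s k v e)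
subst-arg-▷ε s    k (pi b A B)   e =
  gmap _ pi₁ (subst-arg-▷ε s k A e) ◅◅
  gmap _ pi₂ (subst-arg-▷ε s (bump b s k) B (shift-▷ε b 0 e))
subst-arg-▷ε s    k (sig b A B)  e =
  gmap _ sig₁ (subst-arg-▷ε s k A e) ◅◅
  gmap _ sig₂ (subst-arg-▷ε s (bump b s k) B (shift-▷ε b 0 e))
subst-arg-▷ε s    k (pair a c b A B) e =
  gmap _ pair₁ (subst-arg-▷ε s k a e) ◅◅ gmap _ pair₂ (subst-arg-▷ε s k c e) ◅◅
  gmap _ pair₃ (subst-arg-▷ε s k A e) ◅◅
  gmap _ pair₄ (subst-arg-▷ε s (bump b s k) B (shift-▷ε b 0 e))
subst-arg-▷ε s    k (pr1 t)      e = gmap _ pr1₁ (subst-arg-▷ε s k t e)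
subst-arg-▷ε s    k (pr2 b t)    e = gmap _ pr2₁ (subst-arg-▷ε s k t e)
subst-arg-▷ε s    k eps          e = ε

Postponed : Term → Term → Set
Postponed t₁ t₃ = ∃[ t₄ ] (t₁ ▷β t₄ × t₄ ▷ε* t₃)

-- The β-step already reaches the target: the extraction step was erased.
absorbed : ∀ {t₁ t₃} → t₁ ▷β t₃ → Postponed t₁ t₃
absorbed r = _ , r , ε

swapped : ∀ {t₁ t₄ t₃} → t₁ ▷β t₄ → t₄ ▷ε t₃ → Postponed t₁ t₃
swapped r e = _ , r , e ◅ ε

inside : ∀ {t₁ t₃} (f : Term → Term) →
         (∀ {x y} → x ▷β y → f x ▷β f y) → (∀ {x y} → x ▷ε y → f x ▷ε f y) →
         Postponed t₁ t₃ → Postponed (f t₁) (f t₃)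
inside f β-cong ε-cong (t₄ , r , es) = f t₄ , β-cong r , gmap f ε-cong es

extracted-β-normal : ∀ {t t' t''} → ExtrBase t t' → ¬ (t' ▷β t'')
extracted-β-normal e-var (base ())
extracted-β-normal e-lam (base ())
extracted-β-normal e-app (base ())
extracted-β-normal e-pr2 (base ())

-- A root β-redex stays a redex after an extraction step inside it, because
-- the tag of the argument / projected component is unchanged; the contracta
-- are then related by ▷ε* (via the substitution lemmas) or are equal.
postpone-at-root : ∀ {t₁ t₂ t₃} → t₁ ▷ε t₂ → BetaBase t₂ t₃ → Postponed t₁ t₃
postpone-at-root (app₁ (lam₁ e)) (b-app h) = absorbed (base (b-app h))
postpone-at-root (app₁ (lam₂ {star} e)) (b-app h) =
  _ , base (b-app h) , subst-body-▷ε star 0 (λ _ → h) e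
postpone-at-root (app₁ (lam₂ {diam} e)) (b-app h) =
  _ , base (b-app h) , subst-body-▷ε diam 0 (λ ()) e
postpone-at-root (app₂ e) (b-app {b} {t = t} h) =
  _ , base (b-app (tag-backward b e h)) , subst-arg-▷ε b 0 t e
postpone-at-root (pr1₁ (pair₁ e)) (b-pr1 h) = swapped (base (b-pr1 (tag-backward diam e h))) e
postpone-at-root (pr1₁ (pair₂ e)) (b-pr1 h) = absorbed (base (b-pr1 h))
postpone-at-root (pr1₁ (pair₃ e)) (b-pr1 h) = absorbed (base (b-pr1 h))
postpone-at-root (pr1₁ (pair₄ e)) (b-pr1 h) = absorbed (base (b-pr1 h))
postpone-at-root (pr2₁ (pair₁ e)) (b-pr2 h) = absorbed (base (b-pr2 h))
postpone-at-root (pr2₁ (pair₂ e)) (b-pr2 {s} h) = swapped (base (b-pr2 (tag-backward s e h))) e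
postpone-at-root (pr2₁ (pair₃ e)) (b-pr2 h) = absorbed (base (b-pr2 h))
postpone-at-root (pr2₁ (pair₄ e)) (b-pr2 h) = absorbed (base (b-pr2 h))

-- Induction on the extraction step; the β-step is at the root, in the same
-- immediate subterm (induction hypothesis), or in a disjoint one (swap).
lemma3p7 : ∀ {t₁ t₂ t₃ : Term} → t₁ ▷ε t₂ → t₂ ▷β t₃ → ∃[ t₄ ] (t₁ ▷β t₄ × t₄ ▷ε* t₃)
lemma3p7 e         (base r)  = postpone-at-root e r
lemma3p7 (base e)  r         = ⊥-elim (extracted-β-normal e r)
lemma3p7 (lam₁ e)  (lam₁ r)  = inside _ lam₁ lam₁ (lemma3p7 e r)
lemma3p7 (lam₂ e)  (lam₂ r)  = inside _ lam₂ lam₂ (lemma3p7 e r)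
lemma3p7 (app₁ e)  (app₁ r)  = inside _ app₁ app₁ (lemma3p7 e r)
lemma3p7 (app₂ e)  (app₂ r)  = inside _ app₂ app₂ (lemma3p7 e r)
lemma3p7 (pi₁ e)   (pi₁ r)   = inside _ pi₁ pi₁ (lemma3p7 e r)
lemma3p7 (pi₂ e)   (pi₂ r)   = inside _ pi₂ pi₂ (lemma3p7 e r)
lemma3p7 (sig₁ e)  (sig₁ r)  = inside _ sig₁ sig₁ (lemma3p7 e r)
lemma3p7 (sig₂ e)  (sig₂ r)  = inside _ sig₂ sig₂ (lemma3p7 e r)
lemma3p7 (pair₁ e) (pair₁ r) = inside _ pair₁ pair₁ (lemma3p7 e r)
lemma3p7 (pair₂ e) (pair₂ r) = inside _ pair₂ pair₂ (lemma3p7 e r)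
lemma3p7 (pair₃ e) (pair₃ r) = inside _ pair₃ pair₃ (lemma3p7 e r)
lemma3p7 (pair₄ e) (pair₄ r) = inside _ pair₄ pair₄ (lemma3p7 e r)
lemma3p7 (pr1₁ e)  (pr1₁ r)  = inside _ pr1₁ pr1₁ (lemma3p7 e r)
lemma3p7 (pr2₁ e)  (pr2₁ r)  = inside _ pr2₁ pr2₁ (lemma3p7 e r)
lemma3p7 (lam₁ e)  (lam₂ r)  = swapped (lam₂ r) (lam₁ e)
lemma3p7 (lam₂ e)  (lam₁ r)  = swapped (lam₁ r) (lam₂ e)
lemma3p7 (app₁ e)  (app₂ r)  = swapped (app₂ r) (app₁ e)
lemma3p7 (app₂ e)  (app₁ r)  = swapped (app₁ r) (app₂ e)
lemma3p7 (pi₁ e)   (pi₂ r)   = swapped (pi₂ r) (pi₁ e)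
lemma3p7 (pi₂ e)   (pi₁ r)   = swapped (pi₁ r) (pi₂ e)
lemma3p7 (sig₁ e)  (sig₂ r)  = swapped (sig₂ r) (sig₁ e)
lemma3p7 (sig₂ e)  (sig₁ r)  = swapped (sig₁ r) (sig₂ e)
lemma3p7 (pair₁ e) (pair₂ r) = swapped (pair₂ r) (pair₁ e)
lemma3p7 (pair₁ e) (pair₃ r) = swapped (pair₃ r) (pair₁ e)
lemma3p7 (pair₁ e) (pair₄ r) = swapped (pair₄ r) (pair₁ e)
lemma3p7 (pair₂ e) (pair₁ r) = swapped (pair₁ r) (pair₂ e)
lemma3p7 (pair₂ e) (pair₃ r) = swapped (pair₃ r) (pair₂ e)
lemma3p7 (pair₂ e) (pair₄ r) = swapped (pair₄ r) (pair₂ e)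
lemma3p7 (pair₃ e) (pair₁ r) = swapped (pair₁ r) (pair₃ e)
lemma3p7 (pair₃ e) (pair₂ r) = swapped (pair₂ r) (pair₃ e)
lemma3p7 (pair₃ e) (pair₄ r) = swapped (pair₄ r) (pair₃ e)
lemma3p7 (pair₄ e) (pair₁ r) = swapped (pair₁ r) (pair₄ e)
lemma3p7 (pair₄ e) (pair₂ r) = swapped (pair₂ r) (pair₄ e)
lemma3p7 (pair₄ e) (pair₃ r) = swapped (pair₃ r) (pair₄ e)
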